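{- Let $G=(V,E)$ be a connected $r$-regular graph with $r\geq 1$. Then $\displaystyle \chi_i(G) \geq \frac{r}{1 - \frac{\gamma(G)}{|V|}}$.
   Context: $\gamma(G)$ denotes the domination number of $G$: the minimum size of a set $S\subseteq V$ such that every vertex not in $S$ has a neighbor in $S$. For a graph $G$, let $D(G)$ be the digraph obtained by replacing each edge $uv$ by the two opposite arcs $uv$ and $vu$, with arc set $A(G)$. Two distinct arcs $uv$ and $xy$ are adjacent if $u=x$, or $v=x$, or $y=u$. An incidence coloring is a map $\sigma: A(G)\to C$ assigning distinct colors to adjacent arcs; the incidence chromatic number $\chi_i(G)$ is the minimum $|C|$ over all incidence colorings. -}

module Defs where

open import Data.Nat using (ℕ; _≤_)
open import Data.Bool using (Bool; true; false)
open import Data.Fin using (Fin)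
open import Data.Fin.Subset using (Subset; _∈_; ∣_∣)
open import Data.Vec using (tabulate)
open import Data.Product using (Σ; _×_; ∃; ∃-syntax)
open import Data.Sum using (_⊎_)
open import Relation.Nullary using (¬_)
open import Relation.Binary.PropositionalEquality using (_≡_; _≢_)
open import Relation.Binary.Construct.Closure.ReflexiveTransitive using (Star)

record Graph (n : ℕ) : Set where
  field
    adj   : Fin n → Fin n → Bool
    sym   : ∀ u v → adj u v ≡ adj v u
    irrefl : ∀ v → adj v v ≡ false

module _ {n : ℕ} (G : Graph n) where
  open Graph G

  Adj : Fin n → Fin n → Set
  Adj u v = adj u v ≡ true

  N : Fin n → Subset n
  N v = tabulate (adj v)

  degree : Fin n → ℕ
  degree v = ∣ N v ∣

  Regular : ℕ → Set
  Regular r = ∀ v → degree v ≡ r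

  Connected : Set
  Connected = ∀ u v → Star Adj u v

  Dominating : Subset n → Set
  Dominating S = ∀ v → ¬ (v ∈ S) → ∃[ u ] (u ∈ S × Adj u v)

  IsDominationNumber : ℕ → Set
  IsDominationNumber γ =
    (∃[ S ] (Dominating S × ∣ S ∣ ≡ γ)) ×
    (∀ S → Dominating S → γ ≤ ∣ S ∣)

  -- Arcs of D(G): ordered pairs (u , v) with uv ∈ E.
  -- Two distinct arcs uv, xy are adjacent iff u = x, or v = x, or y = u.
  ArcsAdjacent : Fin n → Fin n → Fin n → Fin n → Set
  ArcsAdjacent u v x y = (u ≡ x) ⊎ (v ≡ x) ⊎ (y ≡ u)

  IncidenceColoring : ℕ → Set
  IncidenceColoring k =
    Σ ((u v : Fin n) → Adj u v → Fin k) λ σ →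
      ∀ u v x y (p : Adj u v) (q : Adj x y) →
        ¬ (u ≡ x × v ≡ y) → ArcsAdjacent u v x y → σ u v p ≢ σ x y q

  IsIncidenceChromaticNumber : ℕ → Set
  IsIncidenceChromaticNumber k =
    IncidenceColoring k × (∀ m → IncidenceColoring m → k ≤ m)

-- For a colour c, let T c be the set of tails of arcs coloured c.  If uv has
-- colour c then no arc leaving v has colour c (the two arcs are adjacent), so
-- v ∉ T c: the complement of T c is dominating and |T c| ≤ n − γ.  Each vertex
-- emits r arcs of pairwise distinct colours, so it lies in at least r of the
-- sets T c, and double counting the incidences (u ∈ T c) gives r n ≤ χ (n − γ).
module Submission where

open import Defs
open import Algebra.Properties.CommutativeMonoid.Sum as Sum using ()
open import Axiom.UniquenessOfIdentityProofs using (module Decidable⇒UIP)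
open import Data.Bool using (Bool; true; false)
import Data.Bool.Properties as Bool
open import Data.Empty using (⊥-elim)
open import Data.Fin using (Fin; zero; suc)
open import Data.Fin.Properties using (any?; suc-injective; 0≢1+n) renaming (_≟_ to _≟ᶠ_)
open import Data.Fin.Subset using (Subset; _∈_; _∉_; ∣_∣; ∁; _-_; inside; outside)
open import Data.Fin.Subset.Properties
  using (∣p∣≤n; ∣∁p∣≡n∸∣p∣; x∉∁p⇒x∈p; x∉p⇒x∈∁p; x∈p∧x≢y⇒x∈p-y; x∈p⇒∣p-x∣<∣p∣)
open import Data.Nat using (ℕ; zero; suc; _≤_; _*_; _∸_; _+_; z≤n; s≤s)
open import Data.Nat.Properties
  using (+-0-commutativeMonoid; +-mono-≤; *-comm; ≤-trans; ∸-monoʳ-≤; m∸[m∸n]≡n; module ≤-Reasoning)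
open import Data.Product using (Σ; ∃-syntax; _,_)
open import Data.Sum using (inj₁; inj₂)
open import Data.Vec using (tabulate; []; _∷_; here; there)
open import Data.Vec.Properties using (lookup∘tabulate; lookup⇒[]=; []=⇒lookup)
open import Relation.Nullary using (Dec; does; yes; no)
open import Relation.Nullary.Decidable using (dec-true)
open import Relation.Binary.PropositionalEquality using (_≡_; _≢_; refl; sym; trans; cong; module ≡-Reasoning)

open Sum +-0-commutativeMonoid using (sum-syntax; ∑-comm; sum-cong-≗)

∑-mono-≤ : ∀ {n} {f g : Fin n → ℕ} → (∀ i → f i ≤ g i) → ∑[ i < n ] f i ≤ ∑[ i < n ] g i
∑-mono-≤ {zero}  f≤g = z≤n
∑-mono-≤ {suc n} f≤g = +-mono-≤ (f≤g zero) (∑-mono-≤ (λ i → f≤g (suc i)))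

∑-const : ∀ n x → ∑[ i < n ] x ≡ n * x
∑-const zero    x = refl
∑-const (suc n) x = cong (x +_) (∑-const n x)

indicator : Bool → ℕ
indicator true  = 1
indicator false = 0

∣tabulate∣≡∑ : ∀ {n} (f : Fin n → Bool) → ∣ tabulate f ∣ ≡ ∑[ i < n ] indicator (f i)
∣tabulate∣≡∑ {zero}  f = refl
∣tabulate∣≡∑ {suc n} f with f zero
... | true  = cong suc (∣tabulate∣≡∑ (λ i → f (suc i)))
... | false = ∣tabulate∣≡∑ (λ i → f (suc i))

∈-tabulate⁺ : ∀ {n} {f : Fin n → Bool} {i} → f i ≡ true → i ∈ tabulate f
∈-tabulate⁺ {f = f} {i} fi = lookup⇒[]= i (tabulate f) (trans (lookup∘tabulate f i) fi)

∈-tabulate⁻ : ∀ {n} {f : Fin n → Bool} {i} → i ∈ tabulate f → f i ≡ true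
∈-tabulate⁻ {f = f} {i} i∈ = trans (sym (lookup∘tabulate f i)) ([]=⇒lookup i∈)

∑∣rows∣≡∑∣columns∣ : ∀ {m n} (M : Fin m → Fin n → Bool) →
  ∑[ i < m ] ∣ tabulate (M i) ∣ ≡ ∑[ j < n ] ∣ tabulate (λ i → M i j) ∣
∑∣rows∣≡∑∣columns∣ {m} {n} M = begin
  ∑[ i < m ] ∣ tabulate (M i) ∣                 ≡⟨ sum-cong-≗ (λ i → ∣tabulate∣≡∑ (M i)) ⟩
  ∑[ i < m ] ∑[ j < n ] indicator (M i j)        ≡⟨ ∑-comm (λ i j → indicator (M i j)) ⟩
  ∑[ j < n ] ∑[ i < m ] indicator (M i j)        ≡⟨ sum-cong-≗ (λ j → sym (∣tabulate∣≡∑ (λ i → M i j))) ⟩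
  ∑[ j < n ] ∣ tabulate (λ i → M i j) ∣         ∎
  where open ≡-Reasoning

m≤∣∁p∣⇒∣p∣≤n∸m : ∀ {n m} (p : Subset n) → m ≤ ∣ ∁ p ∣ → ∣ p ∣ ≤ n ∸ m
m≤∣∁p∣⇒∣p∣≤n∸m {n} {m} p m≤∣∁p∣ = begin
  ∣ p ∣            ≡⟨ sym (m∸[m∸n]≡n (∣p∣≤n p)) ⟩
  n ∸ (n ∸ ∣ p ∣)  ≡⟨ cong (n ∸_) (sym (∣∁p∣≡n∸∣p∣ p)) ⟩
  n ∸ ∣ ∁ p ∣      ≤⟨ ∸-monoʳ-≤ n m≤∣∁p∣ ⟩
  n ∸ m            ∎
  where open ≤-Reasoning

injection⇒∣p∣≤∣q∣ : ∀ {m n} {p : Subset m} {q : Subset n} (f : ∀ {i} → i ∈ p → Fin n) →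
  (∀ {i} (i∈p : i ∈ p) → f i∈p ∈ q) →
  (∀ {i j} (i∈p : i ∈ p) (j∈p : j ∈ p) → f i∈p ≡ f j∈p → i ≡ j) →
  ∣ p ∣ ≤ ∣ q ∣
injection⇒∣p∣≤∣q∣ {p = []} f f∈q f-inj = z≤n
injection⇒∣p∣≤∣q∣ {p = outside ∷ p} f f∈q f-inj =
  injection⇒∣p∣≤∣q∣ (λ i∈p → f (there i∈p)) (λ i∈p → f∈q (there i∈p))
    (λ i∈p j∈p eq → suc-injective (f-inj (there i∈p) (there j∈p) eq))
injection⇒∣p∣≤∣q∣ {p = inside ∷ p} {q} f f∈q f-inj = ≤-trans
  (s≤s (injection⇒∣p∣≤∣q∣ {q = q - f here} (λ i∈p → f (there i∈p))
    (λ i∈p → x∈p∧x≢y⇒x∈p-y (f∈q (there i∈p)) (λ eq → 0≢1+n (f-inj here (there i∈p) (sym eq))))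
    (λ i∈p j∈p eq → suc-injective (f-inj (there i∈p) (there j∈p) eq))))
  (x∈p⇒∣p-x∣<∣p∣ (f∈q here))

module _ {n k} (G : Graph n) (colouring : IncidenceColoring G k) where
  open Graph G using (adj; irrefl) renaming (sym to adj-sym)
  open Decidable⇒UIP Bool._≟_ using (≡-irrelevant)
  open Σ colouring renaming (proj₁ to σ; proj₂ to proper)

  ColouredArcFrom : Fin n → Fin k → Set
  ColouredArcFrom u c = ∃[ v ] Σ (Adj G u v) λ uv → σ u v uv ≡ c

  colouredArcFrom? : ∀ u c → Dec (ColouredArcFrom u c)
  colouredArcFrom? u c = any? arcColoured?
    where
    arcColoured? : ∀ v → Dec (Σ (Adj G u v) λ uv → σ u v uv ≡ c)
    arcColoured? v with adj u v Bool.≟ true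
    ... | no ¬uv = no λ (uv , _) → ¬uv uv
    ... | yes uv with σ u v uv ≟ᶠ c
    ...   | yes uv↦c = yes (uv , uv↦c)
    ...   | no uv↦̸c = no λ (uv′ , uv′↦c) → uv↦̸c (trans (cong (σ u v) (≡-irrelevant uv uv′)) uv′↦c)

  emits : Fin n → Fin k → Bool
  emits u c = does (colouredArcFrom? u c)

  tails : Fin k → Subset n
  tails c = tabulate (λ u → emits u c)

  outColours : Fin n → Subset k
  outColours u = tabulate (emits u)

  ∈tails⁻ : ∀ {u c} → u ∈ tails c → ColouredArcFrom u c
  ∈tails⁻ {u} {c} u∈ with colouredArcFrom? u c | ∈-tabulate⁻ u∈
  ... | yes arc | _ = arc

  ∈outColours⁺ : ∀ {u c} → ColouredArcFrom u c → c ∈ outColours u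
  ∈outColours⁺ {u} {c} arc = ∈-tabulate⁺ (dec-true (colouredArcFrom? u c) arc)

  ∈N⁻ : ∀ {u v} → v ∈ N G u → Adj G u v
  ∈N⁻ = ∈-tabulate⁻

  degree≤∣outColours∣ : ∀ u → degree G u ≤ ∣ outColours u ∣
  degree≤∣outColours∣ u = injection⇒∣p∣≤∣q∣
    (λ v∈N → σ u _ (∈N⁻ v∈N))
    (λ v∈N → ∈outColours⁺ (_ , ∈N⁻ v∈N , refl))
    (λ {v} {w} v∈N w∈N same → outArcColour-injective (∈N⁻ v∈N) (∈N⁻ w∈N) same)
    where
    outArcColour-injective : ∀ {v w} (uv : Adj G u v) (uw : Adj G u w) → σ u v uv ≡ σ u w uw → v ≡ w
    outArcColour-injective {v} {w} uv uw same with v ≟ᶠ w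
    ... | yes v≡w = v≡w
    ... | no v≢w = ⊥-elim (proper u v u w uv uw (λ (_ , v≡w) → v≢w v≡w) (inj₁ refl) same)

  Adj⇒≢ : ∀ {u v} → Adj G u v → u ≢ v
  Adj⇒≢ {u} uv refl with trans (sym uv) (irrefl u)
  ... | ()

  ∁tails-dominating : ∀ c → Dominating G (∁ (tails c))
  ∁tails-dominating c v v∉∁T with ∈tails⁻ (x∉∁p⇒x∈p v∉∁T)
  ... | w , vw , vw↦c = w , x∉p⇒x∈∁p w∉T , trans (adj-sym w v) vw
    where
    w∉T : w ∉ tails c
    w∉T w∈T with ∈tails⁻ w∈T
    ... | x , wx , wx↦c =
      proper v w w x vw wx (λ (v≡w , _) → Adj⇒≢ vw v≡w) (inj₂ (inj₁ refl)) (trans vw↦c (sym wx↦c))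

corollary3p2 : ∀ {n : ℕ} (G : Graph n) (r γ χ : ℕ) →
    1 ≤ r → Connected G → Regular G r →
    IsDominationNumber G γ → IsIncidenceChromaticNumber G χ →
    r * n ≤ χ * (n ∸ γ)
corollary3p2 {n} G r γ χ _ _ regular (_ , γ-minimal) (colouring , _) = begin
  r * n                                   ≡⟨ *-comm r n ⟩
  n * r                                   ≡⟨ sym (∑-const n r) ⟩
  ∑[ u < n ] r                            ≡⟨ sum-cong-≗ (λ u → sym (regular u)) ⟩
  ∑[ u < n ] degree G u                   ≤⟨ ∑-mono-≤ (degree≤∣outColours∣ G colouring) ⟩
  ∑[ u < n ] ∣ outColours G colouring u ∣  ≡⟨ ∑∣rows∣≡∑∣columns∣ (emits G colouring) ⟩
  ∑[ c < χ ] ∣ tails G colouring c ∣       ≤⟨ ∑-mono-≤ ∣tails∣≤n∸γ ⟩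
  ∑[ c < χ ] (n ∸ γ)                      ≡⟨ ∑-const χ (n ∸ γ) ⟩
  χ * (n ∸ γ)                             ∎
  where
  open ≤-Reasoning
  ∣tails∣≤n∸γ : ∀ c → ∣ tails G colouring c ∣ ≤ n ∸ γ
  ∣tails∣≤n∸γ c = m≤∣∁p∣⇒∣p∣≤n∸m (tails G colouring c) (γ-minimal _ (∁tails-dominating G colouring c))
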